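{- For $k\ge1$ let $\delta_k=k,(k-1),\dots,1$ be the decreasing permutation of size $k$. For any permutation $\pi$ other than $1$ and $12$, we have \[\sum_{k=1}^{|\pi|}\mu(\delta_k,\pi)=0.\]
   Context: A permutation of size $n$ is a bijection of $[n]$, written as a sequence of values; $|\pi|$ is its size. For $\sigma\in\mathcal{S}_k$, $\pi\in\mathcal{S}_n$, an embedding of $\sigma$ into $\pi$ is a strictly increasing map $f\colon[k]\to[n]$ such that $\pi(f(1)),\dots,\pi(f(k))$ is order-isomorphic to $\sigma(1),\dots,\sigma(k)$; $\sigma\le\pi$ means such an embedding exists. $\mu$ is the Möbius function of this containment poset of all finite permutations: $\mu(x,y)=0$ if $x\not\le y$, $\mu(x,x)=1$, and $\mu(x,y)=-\sum_{x\le z<y}\mu(x,z)$ for $x<y$. -}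

module Defs where

open import Data.Bool using (Bool; true; false; _∧_; _∨_; if_then_else_; T)
open import Data.Nat using (ℕ; zero; suc; _<ᵇ_; _≡ᵇ_)
open import Data.List using (List; []; _∷_; map; _++_; length; concatMap; upTo; downFrom; foldr; filter)
open import Data.List.Properties using (≡-dec)
open import Data.Bool.ListAction using (all; any)
import Data.Nat as N
open import Data.Integer using (ℤ; 0ℤ; 1ℤ; -_; _+_)
open import Relation.Nullary.Decidable using (⌊_⌋)
open import Relation.Binary.PropositionalEquality using (_≡_)

-- A permutation of size n is represented by its one-line notation
-- π(1),…,π(n) as a list of naturals (values in 1..n).

_==_ : List ℕ → List ℕ → Bool
xs == ys = ⌊ ≡-dec N._≟_ xs ys ⌋

range1 : ℕ → List ℕ
range1 n = map suc (upTo n)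

-- a list of length n is a permutation (bijection of [n]) iff it contains every i ∈ [n]
isPermᵇ : List ℕ → Bool
isPermᵇ π = all (λ i → any (λ x → i ≡ᵇ x) π) (range1 (length π))

IsPerm : List ℕ → Set
IsPerm π = T (isPermᵇ π)

seqs : ℕ → ℕ → List (List ℕ)
seqs m zero = [] ∷ []
seqs m (suc len) = concatMap (λ v → map (v ∷_) (seqs m len)) (range1 m)

perms : ℕ → List (List ℕ)
perms m = filter (λ s → T? (isPermᵇ s)) (seqs m m)
  where
  open import Relation.Nullary.Decidable using (T?)

-- order-isomorphism of two sequences of distinct values:
-- same length and for all positions i < j, (a_i < a_j) iff (b_i < b_j)
pairsAgree : ℕ → ℕ → List ℕ → List ℕ → Bool
pairsAgree a b [] [] = true
pairsAgree a b (x ∷ xs) (y ∷ ys) = ((a <ᵇ x) ≡ᵇB (b <ᵇ y)) ∧ pairsAgree a b xs ys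
  where
  _≡ᵇB_ : Bool → Bool → Bool
  true ≡ᵇB true = true
  false ≡ᵇB false = true
  _ ≡ᵇB _ = false
pairsAgree a b _ _ = false

orderIso : List ℕ → List ℕ → Bool
orderIso [] [] = true
orderIso (a ∷ as) (b ∷ bs) = pairsAgree a b as bs ∧ orderIso as bs
orderIso _ _ = false

subseqs : List ℕ → List (List ℕ)
subseqs [] = [] ∷ []
subseqs (x ∷ xs) = map (x ∷_) (subseqs xs) ++ subseqs xs

_≤ᵇ_ : List ℕ → List ℕ → Bool
σ ≤ᵇ π = any (orderIso σ) (subseqs π)

sumℤ : List ℤ → ℤ
sumℤ = foldr _+_ 0ℤ

-- Möbius function with fuel (recursion on |y|); the interval [x, y) consists of
-- permutations z with x ≤ z ≤ y and |z| < |y| (z < y forces |z| < |y|).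
μ-fuel : ℕ → List ℕ → List ℕ → ℤ
μ-fuel zero x y = 0ℤ
μ-fuel (suc f) x y =
  if x ≤ᵇ y
  then (if x == y then 1ℤ
        else - sumℤ (map (μ-fuel f x)
                 (filter (λ z → T? ((x ≤ᵇ z) ∧ (z ≤ᵇ y)))
                   (concatMap perms (upTo (length y))))))
  else 0ℤ
  where
  open import Relation.Nullary.Decidable using (T?)

μ : List ℕ → List ℕ → ℤ
μ x y = μ-fuel (suc (length y)) x y

δ : ℕ → List ℕ
δ k = map suc (downFrom k)

sumFrom1 : ℕ → (ℕ → ℤ) → ℤ
sumFrom1 n f = sumℤ (map f (range1 n))

-- Write Σμδ π for Σₖ μ(δₖ, π). Expanding each μ(δₖ, π) by the defining recursion
-- of μ and exchanging the two sums gives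
--   Σμδ π = #{k : δₖ = π} − Σ_{σ < π} Σμδ σ.
-- Σμδ vanishes on the empty permutation and on 21, and equals 1 on 1 and −1 on 12;
-- by strong induction it vanishes on every permutation of size at least 3, so for
-- such π the sum over σ < π is 1 − [12 ≤ π]. The count #{k : δₖ = π} is also
-- 1 − [12 ≤ π], since the only 12-avoiding permutation of size n is δₙ.
module Submission where

open import Defs
open import Data.Nat using (ℕ)
open import Data.List using (List; []; _∷_; length)
open import Data.Integer using (ℤ; 0ℤ)
open import Relation.Binary.PropositionalEquality using (_≡_; _≢_)

open import Data.Bool using (Bool; true; false; T; if_then_else_; _∧_)
open import Data.Bool.ListAction using (any)
open import Data.Bool.Properties using (T-∧; if-∧)
open import Data.Empty using (⊥-elim)
open import Data.Integer using (_+_; -_; _-_; 1ℤ; -1ℤ)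
import Data.Integer.Properties as ℤ
open import Data.List using (map; _++_; filter; upTo; downFrom; applyUpTo; concatMap)
open import Data.List.Membership.Propositional using (_∈_; find; lose)
open import Data.List.Membership.Propositional.Properties
  using (∈-map⁺; ∈-map⁻; ∈-++⁺ˡ; ∈-++⁺ʳ; ∈-++⁻; ∈-upTo⁺)
import Data.List.Properties as LP
open import Data.List.Relation.Binary.Sublist.Propositional
  using (_⊆_; []; _∷_; _∷ʳ_; ⊆-refl; ⊆-trans; from∈; to∈; minimum)
open import Data.List.Relation.Binary.Sublist.Propositional.Properties using (length-mono-≤)
open import Data.List.Relation.Unary.All as All using (All; []; _∷_)
import Data.List.Relation.Unary.All.Properties as AllP
open import Data.List.Relation.Unary.AllPairs using (AllPairs; []; _∷_)
import Data.List.Relation.Unary.AllPairs.Properties as AllPairsP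
open import Data.List.Relation.Unary.Any as Any using (here; there)
open import Data.List.Relation.Unary.Any.Properties using (any⁺; any⁻)
open import Data.Nat using (suc; zero; _≤_; _<_; _≥_; _>_; _∸_; z≤n; s≤s; _<ᵇ_)
  renaming (_+_ to _+ℕ_)
open import Data.Nat.Induction using (<-wellFounded)
import Data.Nat.Properties as ℕ
open import Data.Product using (∃-syntax; _×_; _,_; proj₂)
open import Data.Sum using (inj₁; inj₂)
open import Data.Unit using (tt)
open import Function using (Equivalence; _∘_)
open import Induction.WellFounded using (Acc; acc)
open import Relation.Binary.PropositionalEquality
  using (refl; sym; trans; cong; cong₂; subst; module ≡-Reasoning)
open import Relation.Nullary using (¬_; yes; no)
open import Relation.Nullary.Decidable using (T?; toWitness; fromWitness)

private
  ∧-intro : ∀ {a b} → T a → T b → T (a ∧ b)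
  ∧-intro ta tb = Equivalence.from T-∧ (ta , tb)

  ∧-elim : ∀ {a b} → T (a ∧ b) → T a × T b
  ∧-elim = Equivalence.to T-∧

if-T : ∀ {A : Set} {b} {x y : A} → T b → (if b then x else y) ≡ x
if-T {b = true} _ = refl

if-¬T : ∀ {A : Set} {b} {x y : A} → ¬ T b → (if b then x else y) ≡ y
if-¬T {b = true} ¬t = ⊥-elim (¬t tt)
if-¬T {b = false} _ = refl

if-0 : ∀ b {v} → v ≡ 0ℤ → (if b then v else 0ℤ) ≡ 0ℤ
if-0 true v≡0 = v≡0
if-0 false _ = refl

-- Pattern containment

∈-subseqs⁺ : ∀ {xs ys : List ℕ} → xs ⊆ ys → xs ∈ subseqs ys
∈-subseqs⁺ [] = here refl
∈-subseqs⁺ (y ∷ʳ τ) = ∈-++⁺ʳ _ (∈-subseqs⁺ τ)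
∈-subseqs⁺ {ys = y ∷ _} (refl ∷ τ) = ∈-++⁺ˡ (∈-map⁺ (y ∷_) (∈-subseqs⁺ τ))

∈-subseqs⁻ : ∀ {xs} ys → xs ∈ subseqs ys → xs ⊆ ys
∈-subseqs⁻ [] (here refl) = []
∈-subseqs⁻ (y ∷ ys) xs∈ with ∈-++⁻ (map (y ∷_) (subseqs ys)) xs∈
... | inj₂ xs∈′ = y ∷ʳ ∈-subseqs⁻ ys xs∈′
... | inj₁ xs∈′ with ∈-map⁻ (y ∷_) xs∈′
...   | _ , s∈ , refl = refl ∷ ∈-subseqs⁻ ys s∈

_≅_ : List ℕ → List ℕ → Set
σ ≅ τ = T (orderIso σ τ)

≤ᵇ⇒embedding : ∀ σ π → T (σ ≤ᵇ π) → ∃[ s ] s ⊆ π × σ ≅ s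
≤ᵇ⇒embedding σ π h with find (any⁻ (orderIso σ) (subseqs π) h)
... | s , s∈ , σ≅s = s , ∈-subseqs⁻ π s∈ , σ≅s

embedding⇒≤ᵇ : ∀ σ {s π} → s ⊆ π → σ ≅ s → T (σ ≤ᵇ π)
embedding⇒≤ᵇ σ s⊆π σ≅s = any⁺ (orderIso σ) (lose (∈-subseqs⁺ s⊆π) σ≅s)

pairsAgree-refl : ∀ a xs → T (pairsAgree a a xs xs)
pairsAgree-refl a [] = tt
pairsAgree-refl a (x ∷ xs) with a <ᵇ x
... | true = pairsAgree-refl a xs
... | false = pairsAgree-refl a xs

pairsAgree-trans : ∀ a b c xs ys zs →
  T (pairsAgree a b xs ys) → T (pairsAgree b c ys zs) → T (pairsAgree a c xs zs)
pairsAgree-trans a b c [] [] [] _ _ = tt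
pairsAgree-trans a b c (x ∷ xs) (y ∷ ys) (z ∷ zs) h₁ h₂ with a <ᵇ x | b <ᵇ y | c <ᵇ z
... | true  | true  | true  = pairsAgree-trans a b c xs ys zs h₁ h₂
... | false | false | false = pairsAgree-trans a b c xs ys zs h₁ h₂
... | true  | false | _     = ⊥-elim h₁
... | false | true  | _     = ⊥-elim h₁
... | _     | true  | false = ⊥-elim h₂
... | _     | false | true  = ⊥-elim h₂

≅-refl : ∀ xs → xs ≅ xs
≅-refl [] = tt
≅-refl (x ∷ xs) = ∧-intro (pairsAgree-refl x xs) (≅-refl xs)

≅-trans : ∀ xs ys zs → xs ≅ ys → ys ≅ zs → xs ≅ zs
≅-trans [] [] [] _ _ = tt
≅-trans (x ∷ xs) (y ∷ ys) (z ∷ zs) h₁ h₂ =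
  let a₁ , b₁ = ∧-elim {pairsAgree x y xs ys} h₁
      a₂ , b₂ = ∧-elim {pairsAgree y z ys zs} h₂
  in ∧-intro (pairsAgree-trans x y z xs ys zs a₁ a₂) (≅-trans xs ys zs b₁ b₂)

≅-length : ∀ xs ys → xs ≅ ys → length xs ≡ length ys
≅-length [] [] _ = refl
≅-length (x ∷ xs) (y ∷ ys) h = cong suc (≅-length xs ys (proj₂ (∧-elim {pairsAgree x y xs ys} h)))

select : ∀ {s z : List ℕ} → s ⊆ z → List ℕ → List ℕ
select (_ ∷ʳ τ) (_ ∷ t) = select τ t
select (_ ∷ τ) (y ∷ t) = y ∷ select τ t
select _ _ = []

select-⊆ : ∀ {s z} (τ : s ⊆ z) t → length z ≡ length t → select τ t ⊆ t
select-⊆ [] [] _ = []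
select-⊆ (_ ∷ʳ τ) (y ∷ t) eq = y ∷ʳ select-⊆ τ t (ℕ.suc-injective eq)
select-⊆ (_ ∷ τ) (y ∷ t) eq = refl ∷ select-⊆ τ t (ℕ.suc-injective eq)

pairsAgree-select : ∀ a b {s z} (τ : s ⊆ z) t →
  T (pairsAgree a b z t) → T (pairsAgree a b s (select τ t))
pairsAgree-select a b [] [] _ = tt
pairsAgree-select a b (x ∷ʳ τ) (y ∷ t) h = pairsAgree-select a b τ t (proj₂ (∧-elim h))
pairsAgree-select a b (refl ∷ τ) (y ∷ t) h =
  let h₁ , h₂ = ∧-elim h in ∧-intro h₁ (pairsAgree-select a b τ t h₂)

≅-select : ∀ {s z} (τ : s ⊆ z) t → z ≅ t → s ≅ select τ t
≅-select [] [] _ = tt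
≅-select {z = x ∷ zs} (_ ∷ʳ τ) (y ∷ t) h = ≅-select τ t (proj₂ (∧-elim {pairsAgree x y zs t} h))
≅-select {z = x ∷ zs} (refl ∷ τ) (y ∷ t) h =
  let h₁ , h₂ = ∧-elim {pairsAgree x y zs t} h
  in ∧-intro (pairsAgree-select x y τ t h₁) (≅-select τ t h₂)

≤ᵇ-refl : ∀ σ → T (σ ≤ᵇ σ)
≤ᵇ-refl σ = embedding⇒≤ᵇ σ ⊆-refl (≅-refl σ)

≤ᵇ-trans : ∀ σ τ π → T (σ ≤ᵇ τ) → T (τ ≤ᵇ π) → T (σ ≤ᵇ π)
≤ᵇ-trans σ τ π σ≤τ τ≤π =
  let s , s⊆τ , σ≅s = ≤ᵇ⇒embedding σ τ σ≤τ
      t , t⊆π , τ≅t = ≤ᵇ⇒embedding τ π τ≤π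
      s′⊆t = select-⊆ s⊆τ t (≅-length τ t τ≅t)
  in embedding⇒≤ᵇ σ (⊆-trans s′⊆t t⊆π) (≅-trans σ s _ σ≅s (≅-select s⊆τ t τ≅t))

≤ᵇ⇒length≤ : ∀ σ π → T (σ ≤ᵇ π) → length σ ≤ length π
≤ᵇ⇒length≤ σ π σ≤π =
  let s , s⊆π , σ≅s = ≤ᵇ⇒embedding σ π σ≤π
  in subst (_≤ length π) (sym (≅-length σ s σ≅s)) (length-mono-≤ s⊆π)

-- Sums of integers

sumℤ-++ : (xs ys : List ℤ) → sumℤ (xs ++ ys) ≡ sumℤ xs + sumℤ ys
sumℤ-++ [] ys = sym (ℤ.+-identityˡ _)
sumℤ-++ (x ∷ xs) ys = trans (cong (x +_) (sumℤ-++ xs ys)) (sym (ℤ.+-assoc x _ _))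

module _ {A : Set} where

  sum-cong : ∀ (f g : A → ℤ) xs → All (λ x → f x ≡ g x) xs → sumℤ (map f xs) ≡ sumℤ (map g xs)
  sum-cong f g [] [] = refl
  sum-cong f g (x ∷ xs) (p ∷ ps) = cong₂ _+_ p (sum-cong f g xs ps)

  sum-zero : ∀ (f : A → ℤ) xs → All (λ x → f x ≡ 0ℤ) xs → sumℤ (map f xs) ≡ 0ℤ
  sum-zero f [] [] = refl
  sum-zero f (x ∷ xs) (p ∷ ps) = cong₂ _+_ p (sum-zero f xs ps)

  sum-+ : ∀ (f g : A → ℤ) xs → sumℤ (map (λ x → f x + g x) xs) ≡ sumℤ (map f xs) + sumℤ (map g xs)
  sum-+ f g [] = refl
  sum-+ f g (x ∷ xs) = trans (cong (f x + g x +_) (sum-+ f g xs)) (interchange (f x) (g x) _ _)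
    where
    open import Algebra.Properties.CommutativeSemigroup ℤ.+-commutativeSemigroup using (interchange)

  sum-neg : ∀ (f : A → ℤ) xs → sumℤ (map (λ x → - f x) xs) ≡ - sumℤ (map f xs)
  sum-neg f [] = refl
  sum-neg f (x ∷ xs) = trans (cong (- f x +_) (sum-neg f xs)) (sym (ℤ.neg-distrib-+ (f x) _))

  sum-filter : ∀ (p : A → Bool) (f : A → ℤ) xs →
    sumℤ (map f (filter (λ x → T? (p x)) xs)) ≡ sumℤ (map (λ x → if p x then f x else 0ℤ) xs)
  sum-filter p f [] = refl
  sum-filter p f (x ∷ xs) with p x
  ... | true = cong (f x +_) (sum-filter p f xs)
  ... | false = trans (sum-filter p f xs) (sym (ℤ.+-identityˡ _))

  if-sum : ∀ b (f : A → ℤ) xs →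
    (if b then sumℤ (map f xs) else 0ℤ) ≡ sumℤ (map (λ x → if b then f x else 0ℤ) xs)
  if-sum true f xs = refl
  if-sum false f xs = sym (sum-zero (λ _ → 0ℤ) xs (All.universal (λ _ → refl) xs))

sum-swap : ∀ {A B : Set} (g : A → B → ℤ) xs ys →
  sumℤ (map (λ x → sumℤ (map (g x) ys)) xs) ≡ sumℤ (map (λ y → sumℤ (map (λ x → g x y) xs)) ys)
sum-swap g [] ys = sym (sum-zero (λ _ → 0ℤ) ys (All.universal (λ _ → refl) ys))
sum-swap g (x ∷ xs) ys = trans (cong (sumℤ (map (g x) ys) +_) (sum-swap g xs ys))
  (sym (sum-+ (g x) (λ y → sumℤ (map (λ x → g x y) xs)) ys))

sumFrom1-suc : ∀ n f → sumFrom1 (suc n) f ≡ sumFrom1 n f + f (suc n)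
sumFrom1-suc n f = begin
  sumℤ (map f (map suc (upTo (suc n))))
    ≡⟨ cong (λ l → sumℤ (map f (map suc l))) (sym (LP.upTo-∷ʳ n)) ⟩
  sumℤ (map f (map suc (upTo n ++ n ∷ [])))
    ≡⟨ cong (sumℤ ∘ map f) (LP.map-++ suc (upTo n) (n ∷ [])) ⟩
  sumℤ (map f (range1 n ++ suc n ∷ []))
    ≡⟨ cong sumℤ (LP.map-++ f (range1 n) (suc n ∷ [])) ⟩
  sumℤ (map f (range1 n) ++ f (suc n) ∷ [])
    ≡⟨ sumℤ-++ (map f (range1 n)) _ ⟩
  sumFrom1 n f + (f (suc n) + 0ℤ)
    ≡⟨ cong (sumFrom1 n f +_) (ℤ.+-identityʳ _) ⟩
  sumFrom1 n f + f (suc n) ∎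
  where open ≡-Reasoning

sumFrom1-truncate : ∀ m n f → m ≤ n → (∀ k → m < k → f k ≡ 0ℤ) → sumFrom1 n f ≡ sumFrom1 m f
sumFrom1-truncate m zero f z≤n _ = refl
sumFrom1-truncate m (suc n) f m≤1+n vanish with m ℕ.≟ suc n
... | yes refl = refl
... | no m≢1+n = begin
  sumFrom1 (suc n) f        ≡⟨ sumFrom1-suc n f ⟩
  sumFrom1 n f + f (suc n)  ≡⟨ cong₂ _+_ (sumFrom1-truncate m n f m≤n vanish)
                                         (vanish (suc n) (s≤s m≤n)) ⟩
  sumFrom1 m f + 0ℤ         ≡⟨ ℤ.+-identityʳ _ ⟩
  sumFrom1 m f              ∎
  where
  open ≡-Reasoning
  m≤n = ℕ.≤-pred (ℕ.≤∧≢⇒< m≤1+n m≢1+n)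

-- The Möbius recursion

permsBelow : ℕ → List (List ℕ)
permsBelow n = concatMap perms (upTo n)

seqs-length : ∀ m len → All (λ z → length z ≡ len) (seqs m len)
seqs-length m zero = refl ∷ []
seqs-length m (suc len) =
  AllP.concat⁺ (AllP.map⁺ (All.universal
    (λ _ → AllP.map⁺ (All.map (cong suc) (seqs-length m len))) (range1 m)))

perms-sized : ∀ {P : ℕ → Set} ns → All P ns → All (λ z → P (length z) × IsPerm z) (concatMap perms ns)
perms-sized {P} ns Pns = AllP.concat⁺ (AllP.map⁺ (All.map sized Pns))
  where
  sized : ∀ {m} → P m → All (λ z → P (length z) × IsPerm z) (perms m)
  sized {m} Pm = All.zipWith (λ (len≡m , p) → subst P (sym len≡m) Pm , p)
    (AllP.filter⁺ _ (seqs-length m m) , AllP.all-filter _ (seqs m m))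

permsBelow-sized : ∀ n → All (λ z → length z < n × IsPerm z) (permsBelow n)
permsBelow-sized n = perms-sized (upTo n) (AllP.applyUpTo⁺₁ (λ i → i) n (λ i<n → i<n))

μ-fuel-irrelevant : ∀ f g x y → length y < f → length y < g → μ-fuel f x y ≡ μ-fuel g x y
μ-fuel-irrelevant (suc f) (suc g) x y (s≤s y<f) (s≤s y<g) =
  cong (λ l → if x ≤ᵇ y then (if x == y then 1ℤ else - sumℤ l) else 0ℤ)
    (LP.map-cong-local (All.map
      (λ (z<y , _) → μ-fuel-irrelevant f g x _ (ℕ.<-≤-trans z<y y<f) (ℕ.<-≤-trans z<y y<g))
      (AllP.filter⁺ _ (permsBelow-sized (length y)))))

μ-fuel≡μ : ∀ f x y → length y < f → μ-fuel f x y ≡ μ x y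
μ-fuel≡μ f x y y<f = μ-fuel-irrelevant f (suc (length y)) x y y<f ℕ.≤-refl

μ-≰ : ∀ x y → ¬ T (x ≤ᵇ y) → μ x y ≡ 0ℤ
μ-≰ x y x≰y = if-¬T {b = x ≤ᵇ y} x≰y

sumBelow : List ℕ → (List ℕ → ℤ) → ℤ
sumBelow π g = sumℤ (map (λ z → if z ≤ᵇ π then g z else 0ℤ) (permsBelow (length π)))

sumBelow-vanishes : ∀ π g → (∀ z → length z < length π → T (z ≤ᵇ π) → g z ≡ 0ℤ) → sumBelow π g ≡ 0ℤ
sumBelow-vanishes π g vanish = sum-zero _ (permsBelow (length π))
  (All.map (λ {z} (z<π , _) → term z z<π) (permsBelow-sized (length π)))
  where
  term : ∀ z → length z < length π → (if z ≤ᵇ π then g z else 0ℤ) ≡ 0ℤ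
  term z z<π with T? (z ≤ᵇ π)
  ... | yes z≤π = trans (if-T {b = z ≤ᵇ π} z≤π) (vanish z z<π z≤π)
  ... | no z≰π = if-¬T {b = z ≤ᵇ π} z≰π

μ-interval-term : ∀ x π z → length z < length π →
  (if (x ≤ᵇ z) ∧ (z ≤ᵇ π) then μ-fuel (length π) x z else 0ℤ) ≡ (if z ≤ᵇ π then μ x z else 0ℤ)
μ-interval-term x π z z<π with T? (x ≤ᵇ z)
... | yes x≤z = begin
  (if (x ≤ᵇ z) ∧ (z ≤ᵇ π) then μ-fuel (length π) x z else 0ℤ)
    ≡⟨ trans (if-∧ (x ≤ᵇ z)) (if-T x≤z) ⟩
  (if z ≤ᵇ π then μ-fuel (length π) x z else 0ℤ)
    ≡⟨ cong (λ v → if z ≤ᵇ π then v else 0ℤ) (μ-fuel≡μ (length π) x z z<π) ⟩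
  (if z ≤ᵇ π then μ x z else 0ℤ) ∎
  where open ≡-Reasoning
... | no x≰z = trans (trans (if-∧ (x ≤ᵇ z)) (if-¬T x≰z)) (sym (if-0 (z ≤ᵇ π) (μ-≰ x z x≰z)))

μ-strict-recursion : ∀ x π → T (x ≤ᵇ π) → ¬ T (x == π) → μ x π ≡ - sumBelow π (μ x)
μ-strict-recursion x π x≤π x≢π = begin
  μ x π
    ≡⟨ trans (if-T {b = x ≤ᵇ π} x≤π) (if-¬T x≢π) ⟩
  - sumℤ (map (μ-fuel (length π) x) (filter (λ z → T? ((x ≤ᵇ z) ∧ (z ≤ᵇ π))) below))
    ≡⟨ cong -_ (sum-filter (λ z → (x ≤ᵇ z) ∧ (z ≤ᵇ π)) _ below) ⟩
  - sumℤ (map (λ z → if (x ≤ᵇ z) ∧ (z ≤ᵇ π) then μ-fuel (length π) x z else 0ℤ) below)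
    ≡⟨ cong -_ (sum-cong _ _ below
         (All.map (λ (z<π , _) → μ-interval-term x π _ z<π) (permsBelow-sized (length π)))) ⟩
  - sumBelow π (μ x) ∎
  where
  open ≡-Reasoning
  below = permsBelow (length π)

μ-recursion : ∀ x π → μ x π ≡ (if x == π then 1ℤ else 0ℤ) - sumBelow π (μ x)
μ-recursion x π with T? (x ≤ᵇ π)
... | no x≰π = begin
  μ x π                                           ≡⟨ μ-≰ x π x≰π ⟩
  0ℤ - 0ℤ                                         ≡⟨ cong₂ _-_ (sym (if-¬T x≢π))
                                                               (sym (sumBelow-vanishes π (μ x) x≰z)) ⟩
  (if x == π then 1ℤ else 0ℤ) - sumBelow π (μ x)  ∎
  where
  open ≡-Reasoning
  x≢π : ¬ T (x == π)
  x≢π x≡π = x≰π (subst (λ y → T (x ≤ᵇ y)) (toWitness x≡π) (≤ᵇ-refl x))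
  x≰z : ∀ z → length z < length π → T (z ≤ᵇ π) → μ x z ≡ 0ℤ
  x≰z z _ z≤π = μ-≰ x z (λ x≤z → x≰π (≤ᵇ-trans x z π x≤z z≤π))
... | yes x≤π with T? (x == π)
...   | yes x≡π = begin
  μ x π                                           ≡⟨ trans (if-T {b = x ≤ᵇ π} x≤π) (if-T x≡π) ⟩
  1ℤ - 0ℤ                                         ≡⟨ cong₂ _-_ (sym (if-T x≡π))
                                                               (sym (sumBelow-vanishes π (μ x) x≰z)) ⟩
  (if x == π then 1ℤ else 0ℤ) - sumBelow π (μ x)  ∎
  where
  open ≡-Reasoning
  x≰z : ∀ z → length z < length π → T (z ≤ᵇ π) → μ x z ≡ 0ℤ
  x≰z z z<π _ = μ-≰ x z (λ x≤z → ℕ.<⇒≱ z<π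
    (subst (λ y → length y ≤ length z) (toWitness x≡π) (≤ᵇ⇒length≤ x z x≤z)))
...   | no x≢π = begin
  μ x π                                           ≡⟨ μ-strict-recursion x π x≤π x≢π ⟩
  - sumBelow π (μ x)                              ≡⟨ sym (ℤ.+-identityˡ _) ⟩
  0ℤ - sumBelow π (μ x)                           ≡⟨ cong (_- sumBelow π (μ x)) (sym (if-¬T x≢π)) ⟩
  (if x == π then 1ℤ else 0ℤ) - sumBelow π (μ x)  ∎
  where open ≡-Reasoning

-- Decreasing permutations

length-δ : ∀ k → length (δ k) ≡ k
length-δ k = trans (LP.length-map suc (downFrom k)) (LP.length-downFrom k)

δ-decreasing : ∀ k → AllPairs _>_ (δ k)
δ-decreasing k = AllPairsP.map⁺ (AllPairsP.applyDownFrom⁺₁ (λ i → i) k (λ j<i _ → s≤s j<i))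

AllPairs-pair : ∀ {R : ℕ → ℕ → Set} {a b xs} → AllPairs R xs → a ∷ b ∷ [] ⊆ xs → R a b
AllPairs-pair (_ ∷ Rxs) (_ ∷ʳ τ) = AllPairs-pair Rxs τ
AllPairs-pair (Rx ∷ _) (refl ∷ τ) = All.lookup Rx (to∈ τ)

pairs⇒AllPairs : ∀ {R : ℕ → ℕ → Set} xs → (∀ {a b} → a ∷ b ∷ [] ⊆ xs → R a b) → AllPairs R xs
pairs⇒AllPairs [] _ = []
pairs⇒AllPairs (x ∷ xs) R-pairs =
  All.tabulate (λ y∈xs → R-pairs (refl ∷ from∈ y∈xs)) ∷ pairs⇒AllPairs xs (R-pairs ∘ (x ∷ʳ_))

12≅⇒ascending : ∀ s → (1 ∷ 2 ∷ []) ≅ s → ∃[ a ] ∃[ b ] s ≡ a ∷ b ∷ [] × a < b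
12≅⇒ascending (a ∷ b ∷ []) h with a <ᵇ b in a<ᵇb
... | true = a , b , refl , ℕ.<ᵇ⇒< a b (subst T (sym a<ᵇb) tt)
12≅⇒ascending s@(_ ∷ _ ∷ _ ∷ _) h with ≅-length (1 ∷ 2 ∷ []) s h
... | ()

ascending⇒12≅ : ∀ {a b} → a < b → (1 ∷ 2 ∷ []) ≅ (a ∷ b ∷ [])
ascending⇒12≅ {a} {b} a<b with a <ᵇ b in a<ᵇb
... | true = tt
... | false = subst T a<ᵇb (ℕ.<⇒<ᵇ a<b)

12≤ᵇ⇒ascent : ∀ π → T ((1 ∷ 2 ∷ []) ≤ᵇ π) → ∃[ a ] ∃[ b ] a < b × a ∷ b ∷ [] ⊆ π
12≤ᵇ⇒ascent π h with ≤ᵇ⇒embedding (1 ∷ 2 ∷ []) π h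
... | s , s⊆π , 12≅s with 12≅⇒ascending s 12≅s
...   | a , b , refl , a<b = a , b , a<b , s⊆π

ascent⇒12≤ᵇ : ∀ {a b π} → a < b → a ∷ b ∷ [] ⊆ π → T ((1 ∷ 2 ∷ []) ≤ᵇ π)
ascent⇒12≤ᵇ a<b τ = embedding⇒≤ᵇ (1 ∷ 2 ∷ []) τ (ascending⇒12≅ a<b)

δ-avoids-12 : ∀ k → ¬ T ((1 ∷ 2 ∷ []) ≤ᵇ δ k)
δ-avoids-12 k h with 12≤ᵇ⇒ascent (δ k) h
... | _ , _ , a<b , τ = ℕ.<-asym a<b (AllPairs-pair (δ-decreasing k) τ)

12-avoiding⇒nonIncreasing : ∀ π → ¬ T ((1 ∷ 2 ∷ []) ≤ᵇ π) → AllPairs _≥_ π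
12-avoiding⇒nonIncreasing π avoids =
  pairs⇒AllPairs π (λ τ → ℕ.≮⇒≥ (λ a<b → avoids (ascent⇒12≤ᵇ a<b τ)))

nonIncreasing≡δ : ∀ n {xs} → length xs ≡ n → AllPairs _≥_ xs →
  (∀ {i} → 0 < i → i ≤ n → i ∈ xs) → xs ≡ δ n
nonIncreasing≡δ zero {[]} _ _ _ = refl
nonIncreasing≡δ (suc m) {x ∷ ys} |xs|≡1+m (x≥ys ∷ ys↓) covers = cong₂ _∷_ x≡1+m ys≡δm
  where
  1+m∈xs : suc m ∈ x ∷ ys
  1+m∈xs = covers (s≤s z≤n) ℕ.≤-refl

  1+m≤x : suc m ≤ x
  1+m≤x with 1+m∈xs
  ... | here 1+m≡x = ℕ.≤-reflexive 1+m≡x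
  ... | there 1+m∈ys = All.lookup x≥ys 1+m∈ys

  ys-covers : ∀ {i} → 0 < i → i ≤ m → i ∈ ys
  ys-covers 0<i i≤m with covers 0<i (ℕ.m≤n⇒m≤1+n i≤m)
  ... | here refl = ⊥-elim (ℕ.<⇒≱ (s≤s i≤m) 1+m≤x)
  ... | there i∈ys = i∈ys

  ys≡δm : ys ≡ δ m
  ys≡δm = nonIncreasing≡δ m (ℕ.suc-injective |xs|≡1+m) ys↓ ys-covers

  x≡1+m : x ≡ suc m
  x≡1+m with 1+m∈xs
  ... | here 1+m≡x = sym 1+m≡x
  ... | there 1+m∈ys with δ-decreasing (suc m)
  ...   | δm<1+m ∷ _ =
    ⊥-elim (ℕ.<-irrefl refl (All.lookup δm<1+m (subst (suc m ∈_) ys≡δm 1+m∈ys)))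

IsPerm⇒covers : ∀ π {i} → IsPerm π → 0 < i → i ≤ length π → i ∈ π
IsPerm⇒covers π {suc j} p _ 1+j≤n =
  Any.map (ℕ.≡ᵇ⇒≡ (suc j) _)
    (any⁻ _ π (All.lookup (AllP.all⁺ _ _ p) (∈-map⁺ suc (∈-upTo⁺ 1+j≤n))))

12-avoiding⇒δ : ∀ π → IsPerm π → ¬ T ((1 ∷ 2 ∷ []) ≤ᵇ π) → π ≡ δ (length π)
12-avoiding⇒δ π p avoids =
  nonIncreasing≡δ (length π) refl (12-avoiding⇒nonIncreasing π avoids) (IsPerm⇒covers π p)

-- The sum Σₖ μ(δₖ, π)

Σμδ : List ℕ → ℤ
Σμδ π = sumFrom1 (length π) (λ k → μ (δ k) π)

countδ : List ℕ → ℤ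
countδ π = sumFrom1 (length π) (λ k → if δ k == π then 1ℤ else 0ℤ)

avoids-12 : List ℕ → ℤ
avoids-12 π = if (1 ∷ 2 ∷ []) ≤ᵇ π then 0ℤ else 1ℤ

Σμδ-extend : ∀ n z → length z ≤ n → sumFrom1 n (λ k → μ (δ k) z) ≡ Σμδ z
Σμδ-extend n z |z|≤n = sumFrom1-truncate (length z) n _ |z|≤n
  (λ k |z|<k → μ-≰ (δ k) z (λ δk≤z →
    ℕ.<⇒≱ |z|<k (subst (_≤ length z) (length-δ k) (≤ᵇ⇒length≤ (δ k) z δk≤z))))

sumFrom1-sumBelow : ∀ π → sumFrom1 (length π) (λ k → sumBelow π (μ (δ k))) ≡ sumBelow π Σμδ
sumFrom1-sumBelow π = begin
  sumℤ (map (λ k → sumℤ (map (λ z → if z ≤ᵇ π then μ (δ k) z else 0ℤ) below)) ks)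
    ≡⟨ sum-swap (λ k z → if z ≤ᵇ π then μ (δ k) z else 0ℤ) ks below ⟩
  sumℤ (map (λ z → sumℤ (map (λ k → if z ≤ᵇ π then μ (δ k) z else 0ℤ) ks)) below)
    ≡⟨ sum-cong _ _ below (All.map (λ {z} (z<π , _) → inner z z<π) (permsBelow-sized (length π))) ⟩
  sumBelow π Σμδ ∎
  where
  open ≡-Reasoning
  ks = range1 (length π)
  below = permsBelow (length π)
  inner : ∀ z → length z < length π →
    sumℤ (map (λ k → if z ≤ᵇ π then μ (δ k) z else 0ℤ) ks) ≡ (if z ≤ᵇ π then Σμδ z else 0ℤ)
  inner z z<π = trans (sym (if-sum (z ≤ᵇ π) (λ k → μ (δ k) z) ks))
    (cong (λ v → if z ≤ᵇ π then v else 0ℤ) (Σμδ-extend (length π) z (ℕ.<⇒≤ z<π)))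

Σμδ-recursion : ∀ π → Σμδ π ≡ countδ π - sumBelow π Σμδ
Σμδ-recursion π = begin
  sumℤ (map (λ k → μ (δ k) π) ks)
    ≡⟨ sum-cong _ _ ks (All.universal (λ k → μ-recursion (δ k) π) ks) ⟩
  sumℤ (map (λ k → (if δ k == π then 1ℤ else 0ℤ) - sumBelow π (μ (δ k))) ks)
    ≡⟨ sum-+ _ _ ks ⟩
  countδ π + sumℤ (map (λ k → - sumBelow π (μ (δ k))) ks)
    ≡⟨ cong (countδ π +_) (trans (sum-neg _ ks) (cong -_ (sumFrom1-sumBelow π))) ⟩
  countδ π - sumBelow π Σμδ ∎
  where
  open ≡-Reasoning
  ks = range1 (length π)

range1-bounded : ∀ n → All (_≤ n) (range1 n)
range1-bounded n = AllP.map⁺ (AllP.applyUpTo⁺₁ (λ i → i) n (λ i<n → i<n))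

countδ-δ : ∀ m → countδ (δ (suc m)) ≡ 1ℤ
countδ-δ m = begin
  sumFrom1 (length (δ (suc m))) f  ≡⟨ cong (λ n → sumFrom1 n f) (length-δ (suc m)) ⟩
  sumFrom1 (suc m) f               ≡⟨ sumFrom1-suc m f ⟩
  sumFrom1 m f + f (suc m)         ≡⟨ cong₂ _+_ (sum-zero f (range1 m) (All.map miss (range1-bounded m)))
                                                (if-T {b = δ (suc m) == δ (suc m)} (fromWitness refl)) ⟩
  0ℤ + 1ℤ                          ∎
  where
  open ≡-Reasoning
  f : ℕ → ℤ
  f k = if δ k == δ (suc m) then 1ℤ else 0ℤ
  miss : ∀ {k} → k ≤ m → f k ≡ 0ℤ
  miss {k} k≤m = if-¬T {b = δ k == δ (suc m)} (λ δk≡δ[1+m] → ℕ.<⇒≢ (s≤s k≤m)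
    (trans (sym (length-δ k)) (trans (cong length (toWitness δk≡δ[1+m])) (length-δ (suc m)))))

countδ-value : ∀ π → 0 < length π → IsPerm π → countδ π ≡ avoids-12 π
countδ-value π@(_ ∷ xs) _ p with T? ((1 ∷ 2 ∷ []) ≤ᵇ π)
... | yes 12≤π = trans
  (sum-zero (λ k → if δ k == π then 1ℤ else 0ℤ) (range1 (length π)) (All.universal miss _))
  (sym (if-T 12≤π))
  where
  miss : ∀ k → (if δ k == π then 1ℤ else 0ℤ) ≡ 0ℤ
  miss k = if-¬T {b = δ k == π} (λ δk≡π →
    δ-avoids-12 k (subst (λ y → T ((1 ∷ 2 ∷ []) ≤ᵇ y)) (sym (toWitness δk≡π)) 12≤π))
... | no avoids = begin
  countδ π                ≡⟨ cong countδ (12-avoiding⇒δ π p avoids) ⟩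
  countδ (δ (length π))   ≡⟨ countδ-δ (length xs) ⟩
  1ℤ                      ≡⟨ sym (if-¬T avoids) ⟩
  avoids-12 π             ∎
  where open ≡-Reasoning

permsOfSizes3+ : ℕ → List (List ℕ)
permsOfSizes3+ m = concatMap perms (applyUpTo (3 +ℕ_) m)

permsBelow-3+ : ∀ m → permsBelow (3 +ℕ m) ≡
  [] ∷ (1 ∷ []) ∷ (1 ∷ 2 ∷ []) ∷ (2 ∷ 1 ∷ []) ∷ permsOfSizes3+ m
permsBelow-3+ m = refl

Σμδ-1 : Σμδ (1 ∷ []) ≡ 1ℤ
Σμδ-1 = refl

Σμδ-12 : Σμδ (1 ∷ 2 ∷ []) ≡ -1ℤ
Σμδ-12 = refl

Σμδ-21 : Σμδ (2 ∷ 1 ∷ []) ≡ 0ℤ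
Σμδ-21 = refl

1≤ᵇnonempty : ∀ x xs → T ((1 ∷ []) ≤ᵇ (x ∷ xs))
1≤ᵇnonempty x xs = embedding⇒≤ᵇ (1 ∷ []) (refl ∷ minimum xs) tt

sumBelow-Σμδ : ∀ π → 3 ≤ length π →
  (∀ z → 3 ≤ length z → length z < length π → IsPerm z → Σμδ z ≡ 0ℤ) →
  sumBelow π Σμδ ≡ avoids-12 π
sumBelow-Σμδ π@(x ∷ xs) 3≤|π| ih = begin
  sumℤ (map term (permsBelow (length π)))
    ≡⟨ cong (sumℤ ∘ map term) (trans (cong permsBelow |π|≡3+m) (permsBelow-3+ m)) ⟩
  term [] + (term (1 ∷ []) + (term (1 ∷ 2 ∷ []) + (term (2 ∷ 1 ∷ [])
    + sumℤ (map term (permsOfSizes3+ m)))))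
    ≡⟨ cong₂ _+_ (if-0 ([] ≤ᵇ π) refl)
       (cong₂ _+_ (trans (if-T {b = (1 ∷ []) ≤ᵇ π} (1≤ᵇnonempty x xs)) Σμδ-1)
       (cong₂ _+_ (cong (λ v → if (1 ∷ 2 ∷ []) ≤ᵇ π then v else 0ℤ) Σμδ-12)
       (cong₂ _+_ (if-0 ((2 ∷ 1 ∷ []) ≤ᵇ π) Σμδ-21) larger-vanish))) ⟩
  0ℤ + (1ℤ + ((if (1 ∷ 2 ∷ []) ≤ᵇ π then -1ℤ else 0ℤ) + (0ℤ + 0ℤ)))
    ≡⟨ tally ((1 ∷ 2 ∷ []) ≤ᵇ π) ⟩
  avoids-12 π ∎
  where
  open ≡-Reasoning
  term : List ℕ → ℤ
  term z = if z ≤ᵇ π then Σμδ z else 0ℤ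
  m = length π ∸ 3
  |π|≡3+m : length π ≡ 3 +ℕ m
  |π|≡3+m = sym (ℕ.m+[n∸m]≡n 3≤|π|)
  larger-vanish : sumℤ (map term (permsOfSizes3+ m)) ≡ 0ℤ
  larger-vanish = sum-zero term (permsOfSizes3+ m) (All.map (λ {z} → vanish {z})
    (perms-sized {P = λ n → 3 ≤ n × n < 3 +ℕ m} (applyUpTo (3 +ℕ_) m)
      (AllP.applyUpTo⁺₁ (3 +ℕ_) m (λ i<m → ℕ.m≤m+n 3 _ , ℕ.+-monoʳ-< 3 i<m))))
    where
    vanish : ∀ {z} → (3 ≤ length z × length z < 3 +ℕ m) × IsPerm z → term z ≡ 0ℤ
    vanish {z} ((3≤|z| , |z|<3+m) , p) =
      if-0 (z ≤ᵇ π) (ih z 3≤|z| (subst (length z <_) (sym |π|≡3+m) |z|<3+m) p)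
  tally : ∀ b → 0ℤ + (1ℤ + ((if b then -1ℤ else 0ℤ) + (0ℤ + 0ℤ))) ≡ (if b then 0ℤ else 1ℤ)
  tally true = refl
  tally false = refl

Σμδ-vanishes : ∀ π → 3 ≤ length π → IsPerm π → Σμδ π ≡ 0ℤ
Σμδ-vanishes π = go π (<-wellFounded (length π))
  where
  go : ∀ π → Acc _<_ (length π) → 3 ≤ length π → IsPerm π → Σμδ π ≡ 0ℤ
  go π (acc smaller) 3≤|π| p = begin
    Σμδ π                          ≡⟨ Σμδ-recursion π ⟩
    countδ π - sumBelow π Σμδ      ≡⟨ cong₂ _-_ (countδ-value π (ℕ.<-≤-trans (s≤s z≤n) 3≤|π|) p)
                                                (sumBelow-Σμδ π 3≤|π| ih) ⟩
    avoids-12 π - avoids-12 π      ≡⟨ ℤ.+-inverseʳ (avoids-12 π) ⟩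
    0ℤ                             ∎
    where
    open ≡-Reasoning
    ih : ∀ z → 3 ≤ length z → length z < length π → IsPerm z → Σμδ z ≡ 0ℤ
    ih z 3≤|z| |z|<|π| = go z (smaller |z|<|π|) 3≤|z|

lemma6 : (π : List ℕ) → IsPerm π → π ≢ 1 ∷ [] → π ≢ 1 ∷ 2 ∷ [] →
    sumFrom1 (length π) (λ k → μ (δ k) π) ≡ 0ℤ
lemma6 [] _ _ _ = refl
lemma6 π@(_ ∷ []) p π≢1 _ with IsPerm⇒covers π {1} p (s≤s z≤n) (s≤s z≤n)
... | here refl = ⊥-elim (π≢1 refl)
lemma6 π@(_ ∷ _ ∷ []) p _ π≢12
  with IsPerm⇒covers π {1} p (s≤s z≤n) (s≤s z≤n) | IsPerm⇒covers π {2} p (s≤s z≤n) ℕ.≤-refl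
... | here refl         | there (here refl) = ⊥-elim (π≢12 refl)
... | there (here refl) | here refl         = Σμδ-21
... | there (here refl) | there (here ())
lemma6 π@(_ ∷ _ ∷ _ ∷ _) p _ _ = Σμδ-vanishes π (s≤s (s≤s (s≤s z≤n))) p
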